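{- There exists a $7\times 36$ sesqui-array on $42$ letters in which each letter occurs exactly $6$ times, any two distinct rows have exactly $30$ letters in common, any row and any column have exactly $6$ letters in common, and the set of numbers of letters common to two distinct columns is exactly $\{0,1,2\}$.
   Context: An $r\times c$ array on a set of $v$ letters has exactly one letter in each cell, with $v>\max\{r,c\}$. Conditions: (A0) no letter occurs more than once in any row or any column; (A1) each letter occurs a constant number $k$ of times; (A2) the number of letters common to any two distinct rows is a non-zero constant; (A4) the number of letters common to any row and any column is a constant. A sesqui-array is such an array satisfying (A0), (A1), (A2) and (A4). -}

module Defs where

open import Data.Nat using (ℕ; zero; suc; _+_; _<_; _⊔_)
open import Data.Fin using (Fin; _≟_)
import Data.Fin as F
open import Data.Bool using (Bool; true; false; if_then_else_; _∧_; _∨_)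
open import Data.Product using (Σ; _×_; _,_)
open import Relation.Nullary using (¬_)
open import Relation.Nullary.Decidable using (⌊_⌋)
open import Relation.Binary.PropositionalEquality using (_≡_)

Array : ℕ → ℕ → ℕ → Set
Array r c v = Fin r → Fin c → Fin v

count : ∀ {n} → (Fin n → Bool) → ℕ
count {zero}  f = 0
count {suc n} f = (if f F.zero then 1 else 0) + count (λ i → f (F.suc i))

anyF : ∀ {n} → (Fin n → Bool) → Bool
anyF {zero}  f = false
anyF {suc n} f = f F.zero ∨ anyF (λ i → f (F.suc i))

sumF : ∀ {n} → (Fin n → ℕ) → ℕ
sumF {zero}  h = 0
sumF {suc n} h = h F.zero + sumF (λ i → h (F.suc i))

module _ {r c v : ℕ} (A : Array r c v) where

  inRow : Fin r → Fin v → Bool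
  inRow i x = anyF (λ j → ⌊ A i j ≟ x ⌋)

  inCol : Fin c → Fin v → Bool
  inCol j x = anyF (λ i → ⌊ A i j ≟ x ⌋)

  occurrences : Fin v → ℕ
  occurrences x = sumF (λ i → count (λ j → ⌊ A i j ≟ x ⌋))

  rowRowCommon : Fin r → Fin r → ℕ
  rowRowCommon i i' = count (λ x → inRow i x ∧ inRow i' x)

  colColCommon : Fin c → Fin c → ℕ
  colColCommon j j' = count (λ x → inCol j x ∧ inCol j' x)

  rowColCommon : Fin r → Fin c → ℕ
  rowColCommon i j = count (λ x → inRow i x ∧ inCol j x)

  A0 : Set
  A0 = (∀ i j j' → A i j ≡ A i j' → j ≡ j')
     × (∀ j i i' → A i j ≡ A i' j → i ≡ i')

  A1 : ℕ → Set
  A1 k = ∀ x → occurrences x ≡ k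

  A2 : ℕ → Set
  A2 l = ∀ i i' → ¬ i ≡ i' → rowRowCommon i i' ≡ l

  A4 : ℕ → Set
  A4 μ = ∀ i j → rowColCommon i j ≡ μ

  IsSesquiArray : Set
  IsSesquiArray = (r ⊔ c < v)
                × A0
                × Σ ℕ A1
                × Σ ℕ (λ l → ¬ l ≡ 0 × A2 l)
                × Σ ℕ A4

  ColumnIntersectionSet : (ℕ → Set) → Set
  ColumnIntersectionSet S =
      (∀ j j' → ¬ j ≡ j' → S (colColCommon j j'))
    × (∀ n → S n → Σ (Fin c) (λ j → Σ (Fin c) (λ j' → ¬ j ≡ j' × colColCommon j j' ≡ n)))

-- Letters are pairs (g , o) ∈ ℤ₇ × ℤ₆ and columns pairs (b , t) ∈ ℤ₆ × ℤ₆; row i puts the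
-- letter (i + b + 1 , t + (i² mod 7)) in column (b , t). Row i is then the set of all letters
-- outside group i, and every column meets every group exactly once, which gives (A0), k = 6,
-- λ = 30 and μ = 6; the quadratic-residue shift is what keeps two columns from sharing more
-- than two letters. Because the entries of a line are distinct, the letters common to two lines
-- are counted as the entries of the first lying on the second, and every condition becomes a
-- finite check that is decided by evaluation.

module Submission where

open import Defs
open import Data.Nat using (ℕ; zero; suc; _+_; _%_; _/_; _^_; _<?_; _⊔_)
import Data.Nat as ℕ
open import Data.Nat.DivMod using (_mod_)
open import Data.Nat.Properties using (+-suc; +-identityʳ)
open import Data.Fin using (Fin; toℕ; combine; _≟_; #_)
import Data.Fin as F
open import Data.Fin.Properties using (all?; toℕ-injective; 0≢1+n; suc-injective)
open import Data.Bool using (Bool; true; false; if_then_else_; _∧_; _∨_)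
open import Data.Bool.Properties using (∧-distribʳ-∨; ∧-zeroʳ)
open import Data.Vec using (Vec; tabulate; lookup)
import Data.Vec as Vec
open import Data.Vec.Properties using (lookup∘tabulate)
open import Data.Vec.Relation.Unary.Any using (any?)
open import Data.Vec.Relation.Unary.AllPairs using (allPairs?)
open import Data.Vec.Relation.Unary.Unique.Propositional using (Unique)
open import Data.Vec.Relation.Unary.Unique.Propositional.Properties using (lookup-injective)
open import Data.Vec.Membership.DecPropositional ℕ._≟_ using (_∈?_)
open import Data.Sum using (_⊎_; inj₁; inj₂)
open import Data.Product using (Σ; _×_; _,_)
open import Function using (_∘_; id)
open import Function.Definitions using (Injective)
open import Relation.Unary using (Pred; Decidable)
open import Relation.Nullary using (Dec; yes; no; does; ¬_; ¬?)
open import Relation.Nullary.Decidable using (⌊_⌋; from-yes; dec-true; dec-false; isYes≗does; ⌊⌋-map′; _⊎-dec_; _→-dec_)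
open import Relation.Binary.PropositionalEquality using (_≡_; refl; sym; trans; cong; cong₂; subst; module ≡-Reasoning)

count-ext : ∀ {n} {f g : Fin n → Bool} → (∀ x → f x ≡ g x) → count f ≡ count g
count-ext {zero}  f≗g = refl
count-ext {suc n} f≗g = cong₂ (λ b m → (if b then 1 else 0) + m) (f≗g F.zero) (count-ext (f≗g ∘ F.suc))

anyF-ext : ∀ {n} {f g : Fin n → Bool} → (∀ x → f x ≡ g x) → anyF f ≡ anyF g
anyF-ext {zero}  f≗g = refl
anyF-ext {suc n} f≗g = cong₂ _∨_ (f≗g F.zero) (anyF-ext (f≗g ∘ F.suc))

count-false : ∀ n → count {n} (λ _ → false) ≡ 0
count-false zero    = refl
count-false (suc n) = count-false n

anyF-false : ∀ {n} {f : Fin n → Bool} → (∀ x → f x ≡ false) → anyF f ≡ false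
anyF-false {zero}  f≗false = refl
anyF-false {suc n} f≗false = cong₂ _∨_ (f≗false F.zero) (anyF-false (f≗false ∘ F.suc))

count-∨ : ∀ {n} (f g : Fin n → Bool) → (∀ x → f x ∧ g x ≡ false) →
          count (λ x → f x ∨ g x) ≡ count f + count g
count-∨ {zero}  f g disjoint = refl
count-∨ {suc n} f g disjoint =
  trans (cong ((if f F.zero ∨ g F.zero then 1 else 0) +_) (count-∨ (f ∘ F.suc) (g ∘ F.suc) (disjoint ∘ F.suc)))
        (indicator-∨ (f F.zero) (g F.zero) (disjoint F.zero))
  where
  indicator-∨ : ∀ a b {m k} → a ∧ b ≡ false →
                (if a ∨ b then 1 else 0) + (m + k) ≡ ((if a then 1 else 0) + m) + ((if b then 1 else 0) + k)
  indicator-∨ true  false     _ = refl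
  indicator-∨ false true  {m} _ = sym (+-suc m _)
  indicator-∨ false false     _ = refl

count-≟-∧ : ∀ {n} (y : Fin n) (P : Fin n → Bool) → count (λ x → ⌊ y ≟ x ⌋ ∧ P x) ≡ (if P y then 1 else 0)
count-≟-∧ {suc n} F.zero    P = trans (cong ((if P F.zero then 1 else 0) +_) (count-false n)) (+-identityʳ _)
count-≟-∧ {suc n} (F.suc y) P =
  trans (count-ext (λ x → cong (_∧ P (F.suc x)) (⌊⌋-map′ _ _ (y ≟ x)))) (count-≟-∧ y (P ∘ F.suc))

count-image : ∀ {n v} (u : Fin n → Fin v) → Injective _≡_ _≡_ u → (P : Fin v → Bool) →
              count (λ x → anyF (λ k → ⌊ u k ≟ x ⌋) ∧ P x) ≡ count (P ∘ u)
count-image {zero} {v} u u-inj P = count-false v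
count-image {suc n} {v} u u-inj P = begin
  count (λ x → (head x ∨ tail x) ∧ P x)
    ≡⟨ count-ext (λ x → ∧-distribʳ-∨ (P x) (head x) (tail x)) ⟩
  count (λ x → (head x ∧ P x) ∨ (tail x ∧ P x))
    ≡⟨ count-∨ _ _ (λ x → disjoint-∧ (head x) (tail x) (P x) (head-tail-disjoint x)) ⟩
  count (λ x → head x ∧ P x) + count (λ x → tail x ∧ P x)
    ≡⟨ cong₂ _+_ (count-≟-∧ (u F.zero) P) (count-image (u ∘ F.suc) (suc-injective ∘ u-inj) P) ⟩
  count (P ∘ u) ∎
  where
  open ≡-Reasoning
  head tail : Fin v → Bool
  head x = ⌊ u F.zero ≟ x ⌋
  tail x = anyF (λ k → ⌊ u (F.suc k) ≟ x ⌋)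
  head-tail-disjoint : ∀ x → head x ∧ tail x ≡ false
  head-tail-disjoint x with u F.zero ≟ x
  ... | no  _    = refl
  ... | yes refl = anyF-false (λ k → trans (isYes≗does _) (dec-false (u (F.suc k) ≟ u F.zero) (0≢1+n ∘ sym ∘ u-inj)))
  disjoint-∧ : ∀ a b p → a ∧ b ≡ false → (a ∧ p) ∧ (b ∧ p) ≡ false
  disjoint-∧ false b     p _ = refl
  disjoint-∧ true  false p _ = ∧-zeroʳ p

-- Deciding equality of unary Fin values is slow; the exhaustive checks below compare the
-- ℕ codes of whole lines, evaluated once per line, with the builtin ℕ equality instead.
codes : ∀ {n v} → (Fin n → Fin v) → Vec ℕ n
codes u = tabulate (toℕ ∘ u)

common : ∀ {m n} → Vec ℕ m → Vec ℕ n → ℕ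
common xs ys = Vec.count (_∈? ys) xs

⌊≟⌋-toℕ : ∀ {v} (a b : Fin v) → ⌊ a ≟ b ⌋ ≡ does (toℕ b ℕ.≟ toℕ a)
⌊≟⌋-toℕ a b with a ≟ b
... | yes refl = sym (dec-true (toℕ a ℕ.≟ toℕ a) refl)
... | no  a≢b  = sym (dec-false (toℕ b ℕ.≟ toℕ a) (a≢b ∘ sym ∘ toℕ-injective))

count-tabulate : ∀ {a p n} {A : Set a} {P : Pred A p} (P? : Decidable P) (f : Fin n → A) →
                 count (λ k → does (P? (f k))) ≡ Vec.count P? (tabulate f)
count-tabulate {n = zero}  P? f = refl
count-tabulate {n = suc n} P? f = indicator-suc (does (P? (f F.zero))) (count-tabulate P? (f ∘ F.suc))
  where
  indicator-suc : ∀ b {m k} → m ≡ k → (if b then 1 else 0) + m ≡ (if b then suc else id) k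
  indicator-suc true  = cong suc
  indicator-suc false = id

anyF-tabulate : ∀ {a p n} {A : Set a} {P : Pred A p} (P? : Decidable P) (f : Fin n → A) →
                anyF (λ k → does (P? (f k))) ≡ does (any? P? (tabulate f))
anyF-tabulate {n = zero}  P? f = refl
anyF-tabulate {n = suc n} P? f = cong (does (P? (f F.zero)) ∨_) (anyF-tabulate P? (f ∘ F.suc))

anyF-≟-∈ : ∀ {n v} (w : Fin n → Fin v) (x : Fin v) → anyF (λ k → ⌊ w k ≟ x ⌋) ≡ does (toℕ x ∈? codes w)
anyF-≟-∈ w x = trans (anyF-ext (λ k → ⌊≟⌋-toℕ (w k) x)) (anyF-tabulate (toℕ x ℕ.≟_) (toℕ ∘ w))

count-common : ∀ {m n v} {u : Fin m → Fin v} (w : Fin n → Fin v) → Injective _≡_ _≡_ u →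
               count (λ x → anyF (λ k → ⌊ u k ≟ x ⌋) ∧ anyF (λ k → ⌊ w k ≟ x ⌋)) ≡ common (codes u) (codes w)
count-common {u = u} w u-inj = begin
  count (λ x → anyF (λ k → ⌊ u k ≟ x ⌋) ∧ anyF (λ k → ⌊ w k ≟ x ⌋))
    ≡⟨ count-image u u-inj _ ⟩
  count (λ k → anyF (λ k' → ⌊ w k' ≟ u k ⌋))
    ≡⟨ count-ext (λ k → anyF-≟-∈ w (u k)) ⟩
  count (λ k → does (toℕ (u k) ∈? codes w))
    ≡⟨ count-tabulate (_∈? codes w) (toℕ ∘ u) ⟩
  common (codes u) (codes w) ∎
  where open ≡-Reasoning

codes-injective : ∀ {n v} {u : Fin n → Fin v} → Unique (codes u) → Injective _≡_ _≡_ u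
codes-injective {u = u} distinct {k} {k'} uk≡uk' = lookup-injective distinct k k' (begin
  lookup (codes u) k   ≡⟨ lookup∘tabulate (toℕ ∘ u) k ⟩
  toℕ (u k)            ≡⟨ cong toℕ uk≡uk' ⟩
  toℕ (u k')           ≡⟨ lookup∘tabulate (toℕ ∘ u) k' ⟨
  lookup (codes u) k'  ∎)
  where open ≡-Reasoning

distinct? : ∀ {n} (xs : Vec ℕ n) → Dec (Unique xs)
distinct? = allPairs? (λ x y → ¬? (x ℕ.≟ y))

column : ∀ {r c v} → Array r c v → Fin c → Fin r → Fin v
column A j i = A i j

module _ {r c v} (A : Array r c v) where

  rowRowCommon≡common : ∀ i i' → Injective _≡_ _≡_ (A i) →
                        rowRowCommon A i i' ≡ common (codes (A i)) (codes (A i'))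
  rowRowCommon≡common i i' = count-common (A i')

  rowColCommon≡common : ∀ i j → Injective _≡_ _≡_ (A i) →
                        rowColCommon A i j ≡ common (codes (A i)) (codes (column A j))
  rowColCommon≡common i j = count-common (column A j)

  colColCommon≡common : ∀ j j' → Injective _≡_ _≡_ (column A j) →
                        colColCommon A j j' ≡ common (codes (column A j)) (codes (column A j'))
  colColCommon≡common j j' = count-common (column A j')

-- combine g o is letter o of group g, and column j is (b , t) = (j / 6 , j % 6).
array : Array 7 36 42
array i j = combine ((toℕ i + toℕ j / 6 + 1) mod 7) ((toℕ j % 6 + toℕ i ^ 2 % 7) mod 6)

AtMostTwo : ℕ → Set
AtMostTwo n = n ≡ 0 ⊎ n ≡ 1 ⊎ n ≡ 2

atMostTwo? : (n : ℕ) → Dec (AtMostTwo n)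
atMostTwo? n = n ℕ.≟ 0 ⊎-dec n ℕ.≟ 1 ⊎-dec n ℕ.≟ 2

rowsDistinct : ∀ i → Unique (codes (array i))
rowsDistinct = from-yes (all? λ i → distinct? (codes (array i)))

columnsDistinct : ∀ j → Unique (codes (column array j))
columnsDistinct = from-yes (all? λ j → distinct? (codes (column array j)))

rowsCommon≡30 : ∀ i i' → ¬ i ≡ i' → common (codes (array i)) (codes (array i')) ≡ 30
rowsCommon≡30 = from-yes (all? λ i → all? λ i' → ¬? (i ≟ i') →-dec common (codes (array i)) (codes (array i')) ℕ.≟ 30)

rowColumnCommon≡6 : ∀ i j → common (codes (array i)) (codes (column array j)) ≡ 6
rowColumnCommon≡6 = from-yes (all? λ i → all? λ j → common (codes (array i)) (codes (column array j)) ℕ.≟ 6)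

columnsCommon≤2 : ∀ j j' → ¬ j ≡ j' → AtMostTwo (common (codes (column array j)) (codes (column array j')))
columnsCommon≤2 = from-yes (all? λ j → all? λ j' → ¬? (j ≟ j') →-dec atMostTwo? (common (codes (column array j)) (codes (column array j'))))

array-rowInjective : ∀ i → Injective _≡_ _≡_ (array i)
array-rowInjective = codes-injective ∘ rowsDistinct

array-columnInjective : ∀ j → Injective _≡_ _≡_ (column array j)
array-columnInjective = codes-injective ∘ columnsDistinct

array-colColCommon : ∀ j j' → colColCommon array j j' ≡ common (codes (column array j)) (codes (column array j'))
array-colColCommon j j' = colColCommon≡common array j j' (array-columnInjective j)

array-A0 : A0 array
array-A0 = (λ i j j' → array-rowInjective i {j} {j'}) , (λ j i i' → array-columnInjective j {i} {i'})

array-A1 : A1 array 6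
array-A1 = from-yes (all? λ x → occurrences array x ℕ.≟ 6)

array-A2 : A2 array 30
array-A2 i i' i≢i' = trans (rowRowCommon≡common array i i' (array-rowInjective i)) (rowsCommon≡30 i i' i≢i')

array-A4 : A4 array 6
array-A4 i j = trans (rowColCommon≡common array i j (array-rowInjective i)) (rowColumnCommon≡6 i j)

array-columnIntersections : ColumnIntersectionSet array AtMostTwo
array-columnIntersections = bounded , realised
  where
  bounded : ∀ j j' → ¬ j ≡ j' → AtMostTwo (colColCommon array j j')
  bounded j j' j≢j' = subst AtMostTwo (sym (array-colColCommon j j')) (columnsCommon≤2 j j' j≢j')
  realised : ∀ n → AtMostTwo n → Σ (Fin 36) (λ j → Σ (Fin 36) (λ j' → ¬ j ≡ j' × colColCommon array j j' ≡ n))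
  realised .0 (inj₁ refl)        = # 0 , # 1 , (λ ()) , array-colColCommon (# 0) (# 1)
  realised .1 (inj₂ (inj₁ refl)) = # 0 , # 6 , (λ ()) , array-colColCommon (# 0) (# 6)
  realised .2 (inj₂ (inj₂ refl)) = # 0 , # 9 , (λ ()) , array-colColCommon (# 0) (# 9)

mainTheorem4 : Σ (Array 7 36 42) (λ A →
                 IsSesquiArray A
                 × A1 A 6
                 × A2 A 30
                 × A4 A 6
                 × ColumnIntersectionSet A (λ n → n ≡ 0 ⊎ n ≡ 1 ⊎ n ≡ 2))
mainTheorem4 =
  array
  , (from-yes (7 ⊔ 36 <? 42) , array-A0 , (6 , array-A1) , (30 , (λ ()) , array-A2) , (6 , array-A4))
  , array-A1 , array-A2 , array-A4 , array-columnIntersections
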